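{- Let $v \geq 2$ be an integer. Then $d(2,2) = 1$, and for $v \geq 3$, \[ d(2,v) \leq \frac{v}{\log_2\left(\frac{v^v (v-2)^{v-2}}{(v-1)^{2(v-1)}}\right)}. \]
   Context: For integers $N,t,k,v \geq 1$, a covering array $CA(N;t,k,v)$ is an $N \times k$ array $A$ with entries from a set $V$ of size $v$ such that for every choice of $t$ columns of $A$, the set of rows of the $N \times t$ subarray on those columns contains every element of $V^t$. $CAN(t,k,v)$ denotes the smallest $N$ for which a $CA(N;t,k,v)$ exists, and \[ d(t,v) = \limsup_{k \to \infty} \frac{CAN(t,k,v)}{\log_2 k}. \] -}

module Defs where

open import Data.Nat using (ℕ; suc; _+_; _*_; _∸_; _^_; _≤_; _<_; _≥_)
open import Data.Fin using (Fin)
open import Data.Product using (Σ; ∃; _×_)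
open import Relation.Binary.PropositionalEquality using (_≡_)
open import Function.Definitions using (Injective)

Array : ℕ → ℕ → ℕ → Set
Array N k v = Fin N → Fin k → Fin v

IsCoveringArray : (N t k v : ℕ) → Array N k v → Set
IsCoveringArray N t k v A =
  (c : Fin t → Fin k) → Injective _≡_ _≡_ c →
  (x : Fin t → Fin v) → ∃ λ (r : Fin N) → (i : Fin t) → A r (c i) ≡ x i

CA : (N t k v : ℕ) → Set
CA N t k v = Σ (Array N k v) (IsCoveringArray N t k v)

-- CAN(t,k,v) ≤ (p/q)·log₂ k, i.e. some CA(N;t,k,v) has 2^(qN) ≤ k^p.
CAN≤ : (t k v p q : ℕ) → Set
CAN≤ t k v p q = ∃ λ N → CA N t k v × (2 ^ (q * N) ≤ k ^ p)

-- CAN(t,k,v) > (p/q)·log₂ k, i.e. every CA(N;t,k,v) has 2^(qN) > k^p.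
CAN> : (t k v p q : ℕ) → Set
CAN> t k v p q = ∀ N → CA N t k v → k ^ p < 2 ^ (q * N)

-- d(t,v) ≤ p/q  (limsup bound) for a rational r = p/q, q ≥ 1, strictly
-- above the claimed value: eventually CAN(t,k,v) ≤ r·log₂ k.
EventuallyCAN≤ : (t v p q : ℕ) → Set
EventuallyCAN≤ t v p q = ∃ λ K → ∀ k → k ≥ K → CAN≤ t k v p q

FrequentlyCAN> : (t v p q : ℕ) → Set
FrequentlyCAN> t v p q = ∀ K → ∃ λ k → k ≥ K × CAN> t k v p q

-- d(t,v) ≤ c for a real c, given by a "strictly above c" predicate on
-- rationals p/q (q ≥ 1):  every rational above c is eventually an upper bound.
dLe : (t v : ℕ) → (ℕ → ℕ → Set) → Set
dLe t v Above = ∀ p q → 1 ≤ q → Above p q → EventuallyCAN≤ t v p q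

-- d(t,v) ≥ c: every rational below c is exceeded infinitely often.
dGe : (t v : ℕ) → (ℕ → ℕ → Set) → Set
dGe t v Below = ∀ p q → 1 ≤ q → Below p q → FrequentlyCAN> t v p q

Above1 : ℕ → ℕ → Set
Above1 p q = q < p

Below1 : ℕ → ℕ → Set
Below1 p q = p < q

-- p/q > v / log₂(v^v (v-2)^(v-2) / (v-1)^(2(v-1)))
--   ⇔ (v^v (v-2)^(v-2))^p > 2^(vq) · (v-1)^(2(v-1)p)    (for v ≥ 3, q ≥ 1)
AboveBound : ℕ → ℕ → ℕ → Set
AboveBound v p q =
  2 ^ (v * q) * (v ∸ 1) ^ (2 * (v ∸ 1) * p) < (v ^ v * (v ∸ 2) ^ (v ∸ 2)) ^ p

-- For t = 2, covering means that any two distinct columns show every pair of symbols,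
-- and such arrays multiply: rows add up and column counts multiply. Hence one array
-- with N₀ rows and k₀ columns such that 2^(q N₀) < k₀^p yields, through its powers,
-- CAN(2,k,v) ≤ (p/q) log₂ k for all large k. Base arrays come from an antichain of
-- subsets of an L-set: one row for each point x and each pair of symbols a < b
-- (entry a where the column's set contains x, b elsewhere) and v constant rows.
-- The largest layer of the Boolean lattice has at least 2^L/(L+1) sets, giving that
-- many columns on L·C(v,2) + v rows. Letting L → ∞ gives d(2,2) ≤ 1; for v ≥ 3 the
-- choice L = 60 already beats the stated bound, by (1 + 1/m)^(m+1) ≤ 27/8 for m ≥ 2.
-- Conversely, the columns of a binary covering array are distinct, so k ≤ 2^N.

module Submission where

open import Defs
open import Data.Nat using (ℕ; zero; suc; _+_; _*_; _∸_; _^_; _≤_; _<_; _≥_; z≤n; s≤s; s≤s⁻¹; z<s; NonZero; >-nonZero; _≤?_)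
open import Data.Nat.Properties
open import Data.Nat.Tactic.RingSolver using (solve-∀)
open import Data.Bool using (Bool; true; false; if_then_else_)
open import Data.Fin using (Fin; zero; suc; splitAt; _↑ˡ_; _↑ʳ_; remQuot; combine; inject≤; funToFin; finToFun)
  renaming (_≟_ to _≟ᶠ_; _<_ to _<ᶠ_)
open import Data.Fin.Properties
  using (splitAt-↑ˡ; splitAt-↑ʳ; splitAt⁻¹-↑ˡ; splitAt⁻¹-↑ʳ; remQuot-combine; combine-remQuot; inject≤-injective; finToFun-funToFin; injective⇒≤)
  renaming (<-cmp to <-cmpᶠ)
open import Data.Vec.Functional using ([]; _∷_; head; tail)
open import Data.Product using (Σ; ∃; _×_; _,_; proj₁; proj₂; uncurry; map)
open import Data.Sum using (inj₁; inj₂; [_,_]′)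
open import Data.Unit using (tt)
open import Relation.Nullary using (yes; no; contradiction)
open import Relation.Binary using (tri<; tri≈; tri>)
open import Relation.Binary.PropositionalEquality
open import Algebra.Properties.CommutativeSemigroup +-commutativeSemigroup using () renaming (interchange to +-interchange)
open import Algebra.Properties.CommutativeSemigroup *-commutativeSemigroup using (xy∙z≈xz∙y; xy∙z≈x∙zy; x∙yz≈y∙xz)
open import Function.Base using (_∘_)
open import Function.Definitions using (Injective)

-- Pair-covering arrays

IsPairCovering : (N k v : ℕ) → Array N k v → Set
IsPairCovering N k v A =
  ∀ i j → i ≢ j → ∀ a b → ∃ λ r → A r i ≡ a × A r j ≡ b

PairCA : (N k v : ℕ) → Set
PairCA N k v = Σ (Array N k v) (IsPairCovering N k v)

PairCA⇒CA : ∀ {N k v} → PairCA N k v → CA N 2 k v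
PairCA⇒CA (A , cover) = A , λ c c-inj x →
  let r , e₀ , e₁ = cover (c zero) (c (suc zero)) (λ e → 0≢1 (c-inj e)) (x zero) (x (suc zero))
  in r , λ { zero → e₀ ; (suc zero) → e₁ }
  where
  0≢1 : zero ≢ suc (zero {0})
  0≢1 ()

PairCA-restrict : ∀ {N k k′ v} → k′ ≤ k → PairCA N k v → PairCA N k′ v
PairCA-restrict k′≤k (A , cover) =
  (λ r c → A r (inject≤ c k′≤k)) ,
  λ i j i≢j → cover (inject≤ i k′≤k) (inject≤ j k′≤k) (λ e → i≢j (inject≤-injective k′≤k k′≤k i j e))

-- Two distinct columns of the product differ in some factor, whose rows cover them.
PairCA-product : ∀ {N N′ k k′ v} → PairCA N k v → PairCA N′ k′ v → PairCA (N + N′) (k * k′) v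
PairCA-product {N} {N′} {k} {k′} {v} (A , coverA) (B , coverB) = C , coverC
  where
  split : Fin (k * k′) → Fin k × Fin k′
  split = remQuot {k} k′

  C : Array (N + N′) (k * k′) v
  C r c = [ (λ r₁ → A r₁ (proj₁ (split c))) , (λ r₂ → B r₂ (proj₂ (split c))) ]′ (splitAt N r)

  C-↑ˡ : ∀ r c → C (r ↑ˡ N′) c ≡ A r (proj₁ (split c))
  C-↑ˡ r c = cong [ _ , _ ]′ (splitAt-↑ˡ N r N′)

  C-↑ʳ : ∀ r c → C (N ↑ʳ r) c ≡ B r (proj₂ (split c))
  C-↑ʳ r c = cong [ _ , _ ]′ (splitAt-↑ʳ N N′ r)

  split-injective : ∀ i j → split i ≡ split j → i ≡ j
  split-injective i j e =
    trans (sym (combine-remQuot {k} k′ i)) (trans (cong (uncurry combine) e) (combine-remQuot {k} k′ j))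

  coverC : IsPairCovering (N + N′) (k * k′) v C
  coverC i j i≢j a b with proj₁ (split i) ≟ᶠ proj₁ (split j)
  ... | no ne =
    let r , ea , eb = coverA _ _ ne a b
    in r ↑ˡ N′ , trans (C-↑ˡ r i) ea , trans (C-↑ˡ r j) eb
  ... | yes e₁ =
    let r , ea , eb = coverB _ _ (λ e₂ → i≢j (split-injective i j (cong₂ _,_ e₁ e₂))) a b
    in N ↑ʳ r , trans (C-↑ʳ r i) ea , trans (C-↑ʳ r j) eb

PairCA-power : ∀ {N k v} → PairCA N k v → ∀ M → PairCA (M * N) (k ^ M) v
PairCA-power _ zero = (λ ()) , λ { zero zero 0≢0 → contradiction refl 0≢0 }
PairCA-power base (suc M) = PairCA-product base (PairCA-power base M)

-- Amplification by powers

^-distribʳ-* : ∀ m n o → (m * n) ^ o ≡ m ^ o * n ^ o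
^-distribʳ-* m n zero = refl
^-distribʳ-* m n (suc o) = begin
  m * n * (m * n) ^ o       ≡⟨ cong (m * n *_) (^-distribʳ-* m n o) ⟩
  m * n * (m ^ o * n ^ o)   ≡⟨ [m*n]*[o*p]≡[m*o]*[n*p] m n (m ^ o) (n ^ o) ⟩
  m * m ^ o * (n * n ^ o)   ∎
  where open ≡-Reasoning

^-double : ∀ m k → m ^ (2 * k) ≡ m ^ k * m ^ k
^-double m k = trans (cong (λ x → m ^ (k + x)) (+-identityʳ k)) (^-distribˡ-+-* m k k)

^-*-comm : ∀ m h a → m ^ (h * a) ≡ (m ^ a) ^ h
^-*-comm m h a = trans (cong (m ^_) (*-comm h a)) (sym (^-*-assoc m a h))

-- In real terms: (1 - x)ⁿ (1 + n x) ≤ 1 for x = 1/(w+1).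
bernoulli : ∀ w n → w ^ n * (suc w + n) ≤ suc w ^ suc n
bernoulli w zero = ≤-reflexive (trans (*-identityˡ (suc w + 0)) (trans (+-identityʳ (suc w)) (sym (*-identityʳ (suc w)))))
bernoulli w (suc n) = begin
  w * w ^ n * (suc w + suc n)    ≡⟨ regroup w (w ^ n) n ⟩
  w ^ n * (w * (suc w + suc n))  ≤⟨ *-monoʳ-≤ (w ^ n) (≤-trans (m≤m+n _ (suc n)) (≤-reflexive (expand w n))) ⟩
  w ^ n * ((suc w + n) * suc w)  ≡⟨ sym (*-assoc (w ^ n) _ _) ⟩
  w ^ n * (suc w + n) * suc w    ≤⟨ *-monoˡ-≤ (suc w) (bernoulli w n) ⟩
  suc w ^ suc n * suc w          ≡⟨ *-comm (suc w ^ suc n) (suc w) ⟩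
  suc w * suc w ^ suc n          ∎
  where
  open ≤-Reasoning
  regroup : ∀ w x n → w * x * (suc w + suc n) ≡ x * (w * (suc w + suc n))
  regroup = solve-∀
  expand : ∀ w n → w * (suc w + suc n) + suc n ≡ (suc w + n) * suc w
  expand = solve-∀

m^[1+n]≤[1+m]^n : ∀ m n → m * m ≤ n → m ^ suc n ≤ suc m ^ n
m^[1+n]≤[1+m]^n m n m*m≤n = *-cancelʳ-≤ (m ^ suc n) (suc m ^ n) (suc m) (begin
  m * m ^ n * suc m      ≡⟨ regroup m (m ^ n) ⟩
  m ^ n * (m + m * m)    ≤⟨ *-monoʳ-≤ (m ^ n) (m≤n⇒m≤1+n (+-monoʳ-≤ m m*m≤n)) ⟩
  m ^ n * (suc m + n)    ≤⟨ bernoulli m n ⟩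
  suc m ^ suc n          ≡⟨ *-comm (suc m) (suc m ^ n) ⟩
  suc m ^ n * suc m      ∎)
  where
  open ≤-Reasoning
  regroup : ∀ m x → m * x * suc m ≡ x * (m + m * m)
  regroup = solve-∀

power-bracket : ∀ {b k} → 1 < b → 1 < k → ∃ λ n → b ^ n < k × k ≤ b ^ suc n
power-bracket {k = suc zero} _ (s≤s ())
power-bracket {b} {suc (suc zero)} 1<b _ = 0 , ≤-refl , subst (2 ≤_) (sym (*-identityʳ b)) 1<b
power-bracket {b} {suc (suc (suc j))} 1<b _ with power-bracket {b} {suc (suc j)} 1<b (s≤s (s≤s z≤n))
... | n , lo , hi with m≤n⇒m<n∨m≡n hi
...   | inj₁ hi< = n , m<n⇒m<1+n lo , hi<
...   | inj₂ k≡bⁿ⁺¹ = suc n , subst (_< suc (suc (suc j))) k≡bⁿ⁺¹ ≤-refl ,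
                      subst (λ x → suc x ≤ b ^ suc (suc n)) (sym k≡bⁿ⁺¹) (^-monoʳ-< b 1<b (n<1+n (suc n)))

1<m^n⇒1<m : ∀ m n → 1 < m ^ n → 1 < m
1<m^n⇒1<m zero zero (s≤s ())
1<m^n⇒1<m (suc zero) n 1<1ⁿ = contradiction (^-zeroˡ n) (>⇒≢ 1<1ⁿ)
1<m^n⇒1<m (suc (suc m)) n _ = s≤s (s≤s z≤n)

-- For k₀ⁿ < k ≤ k₀ⁿ⁺¹ use the (n+1)-th power; the rounding is absorbed because
-- (2^(q N₀))^(n+1) ≤ (2^(q N₀) + 1)^n once n is large.
eventuallyCAN≤-fromPairCA : ∀ {N₀ k₀ v} p q → PairCA N₀ k₀ v → 2 ^ (q * N₀) < k₀ ^ p →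
                            EventuallyCAN≤ 2 v p q
eventuallyCAN≤-fromPairCA {N₀} {k₀} {v} p q base 2^qN₀<k₀^p = suc (k₀ ^ (a * a)) , large
  where
  a : ℕ
  a = 2 ^ (q * N₀)
  1<k₀ : 1 < k₀
  1<k₀ = 1<m^n⇒1<m k₀ p (≤-<-trans (m^n>0 2 (q * N₀)) 2^qN₀<k₀^p)
  instance
    k₀≢0 : NonZero k₀
    k₀≢0 = >-nonZero (<-trans z<s 1<k₀)

  large : ∀ k → k ≥ suc (k₀ ^ (a * a)) → CAN≤ 2 k v p q
  large k k>k₀^aa with power-bracket 1<k₀ (≤-trans (s≤s (m^n>0 k₀ (a * a))) k>k₀^aa)
  ... | n , k₀ⁿ<k , k≤k₀ⁿ⁺¹ =
    suc n * N₀ , PairCA⇒CA (PairCA-restrict k≤k₀ⁿ⁺¹ (PairCA-power base (suc n))) , bound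
    where
    a*a≤n : a * a ≤ n
    a*a≤n = ≮⇒≥ λ n<aa → <-irrefl refl (begin-strict
      k               ≤⟨ k≤k₀ⁿ⁺¹ ⟩
      k₀ ^ suc n      ≤⟨ ^-monoʳ-≤ k₀ n<aa ⟩
      k₀ ^ (a * a)    <⟨ k>k₀^aa ⟩
      k               ∎)
      where open ≤-Reasoning
    bound : 2 ^ (q * (suc n * N₀)) ≤ k ^ p
    bound = begin
      2 ^ (q * (suc n * N₀))  ≡⟨ cong (2 ^_) (reorder q n N₀) ⟩
      2 ^ (q * N₀ * suc n)    ≡⟨ sym (^-*-assoc 2 (q * N₀) (suc n)) ⟩
      a ^ suc n               ≤⟨ m^[1+n]≤[1+m]^n a n a*a≤n ⟩
      suc a ^ n               ≤⟨ ^-monoˡ-≤ n 2^qN₀<k₀^p ⟩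
      (k₀ ^ p) ^ n            ≡⟨ ^-*-assoc k₀ p n ⟩
      k₀ ^ (p * n)            ≡⟨ cong (k₀ ^_) (*-comm p n) ⟩
      k₀ ^ (n * p)            ≡⟨ sym (^-*-assoc k₀ n p) ⟩
      (k₀ ^ n) ^ p            ≤⟨ ^-monoˡ-≤ p (<⇒≤ k₀ⁿ<k) ⟩
      k ^ p                   ∎
      where
      open ≤-Reasoning
      reorder : ∀ q n N → q * (suc n * N) ≡ q * N * suc n
      reorder = solve-∀

-- Covering arrays from antichains

pairs : ℕ → ℕ
pairs zero = 0
pairs (suc v) = v + pairs v

-- The pairs a < b of Fin v: first those with a = 0, then the shifted pairs of Fin (v - 1).
pair : ∀ v → Fin (pairs v) → Fin v × Fin v
pair (suc v) t = [ (λ b → zero , suc b) , (λ t′ → map suc suc (pair v t′)) ]′ (splitAt v t)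

pair-surjective : ∀ v {a b : Fin v} → a <ᶠ b → ∃ λ t → pair v t ≡ (a , b)
pair-surjective (suc v) {zero} {suc b} _ =
  b ↑ˡ pairs v , cong [ _ , _ ]′ (splitAt-↑ˡ v b (pairs v))
pair-surjective (suc v) {suc a} {suc b} a<b =
  let t , e = pair-surjective v (s≤s⁻¹ a<b)
  in v ↑ʳ t , trans (cong [ _ , _ ]′ (splitAt-↑ʳ v (pairs v) t)) (cong (map suc suc) e)

pairs-double : ∀ v → pairs (suc v) * 2 ≡ suc v * v
pairs-double zero = refl
pairs-double (suc v) = begin
  (suc v + pairs (suc v)) * 2       ≡⟨ *-distribʳ-+ 2 (suc v) (pairs (suc v)) ⟩
  suc v * 2 + pairs (suc v) * 2     ≡⟨ cong (suc v * 2 +_) (pairs-double v) ⟩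
  suc v * 2 + suc v * v             ≡⟨ regroup v ⟩
  suc (suc v) * suc v               ∎
  where
  open ≡-Reasoning
  regroup : ∀ v → suc v * 2 + suc v * v ≡ suc (suc v) * suc v
  regroup = solve-∀

_⊈_ : ∀ {L} → (Fin L → Bool) → (Fin L → Bool) → Set
s ⊈ t = ∃ λ p → s p ≡ true × t p ≡ false

IsAntichain : ∀ {k L} → (Fin k → Fin L → Bool) → Set
IsAntichain S = ∀ i j → i ≢ j → S i ⊈ S j

antichain-PairCA : ∀ {k L} v (S : Fin k → Fin L → Bool) → IsAntichain S → PairCA (L * pairs v + v) k v
antichain-PairCA {k} {L} v S antichain = A , cover
  where
  choice : Fin L → Fin (pairs v) → Fin k → Fin v
  choice p t c = if S c p then proj₁ (pair v t) else proj₂ (pair v t)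

  A : Array (L * pairs v + v) k v
  A r c = [ (λ pt → uncurry choice (remQuot (pairs v) pt) c) , (λ a → a) ]′ (splitAt (L * pairs v) r)

  A-choice : ∀ p t c → A (combine p t ↑ˡ v) c ≡ choice p t c
  A-choice p t c = trans (cong [ _ , _ ]′ (splitAt-↑ˡ (L * pairs v) (combine p t) v))
                         (cong (λ pt → uncurry choice pt c) (remQuot-combine p t))

  A-constant : ∀ a c → A ((L * pairs v) ↑ʳ a) c ≡ a
  A-constant a c = cong [ _ , _ ]′ (splitAt-↑ʳ (L * pairs v) v a)

  separate : ∀ i j → i ≢ j → ∀ a b → a <ᶠ b → ∃ λ r → A r i ≡ a × A r j ≡ b
  separate i j i≢j a b a<b =
    let p , Sip , Sjp = antichain i j i≢j
        t , pair≡ab = pair-surjective v a<b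
    in combine p t ↑ˡ v ,
       trans (A-choice p t i) (trans (cong (λ x → if x then _ else _) Sip) (cong proj₁ pair≡ab)) ,
       trans (A-choice p t j) (trans (cong (λ x → if x then _ else _) Sjp) (cong proj₂ pair≡ab))

  cover : IsPairCovering (L * pairs v + v) k v A
  cover i j i≢j a b with <-cmpᶠ a b
  ... | tri< a<b _ _ = separate i j i≢j a b a<b
  ... | tri≈ _ refl _ = (L * pairs v) ↑ʳ a , A-constant a i , A-constant a j
  ... | tri> _ _ b<a = let r , e₁ , e₂ = separate j i (i≢j ∘ sym) b a b<a in r , e₂ , e₁

-- The largest layer of the Boolean lattice

choose : ℕ → ℕ → ℕ
choose zero zero = 1
choose zero (suc w) = 0
choose (suc L) zero = 1
choose (suc L) (suc w) = choose L w + choose L (suc w)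

-- The w-element subsets of Fin L, as characteristic functions, listed by Pascal's rule.
subset : ∀ L w → Fin (choose L w) → Fin L → Bool
subset zero zero _ ()
subset (suc L) zero _ _ = false
subset (suc L) (suc w) i =
  [ (λ j → true ∷ subset L w j) , (λ j → false ∷ subset L (suc w) j) ]′ (splitAt (choose L w) i)

size : ∀ {L} → (Fin L → Bool) → ℕ
size {zero} _ = 0
size {suc L} s = if head s then suc (size (tail s)) else size (tail s)

size-const-false : ∀ L → size {L} (λ _ → false) ≡ 0
size-const-false zero = refl
size-const-false (suc L) = size-const-false L

size-subset : ∀ L w i → size (subset L w i) ≡ w
size-subset zero zero i = refl
size-subset (suc L) zero i = size-const-false L
size-subset (suc L) (suc w) i with splitAt (choose L w) i
... | inj₁ j = cong suc (size-subset L w j)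
... | inj₂ j = size-subset L (suc w) j

⊈-tail : ∀ {L} {s t : Fin (suc L) → Bool} → tail s ⊈ tail t → s ⊈ t
⊈-tail (p , e) = suc p , e

size<⇒⊈ : ∀ {L} (s t : Fin L → Bool) → size t < size s → s ⊈ t
size<⇒⊈ {suc L} s t t<s with s zero in s₀ | t zero in t₀
... | true  | false = zero , s₀ , t₀
... | true  | true  = ⊈-tail (size<⇒⊈ (tail s) (tail t) (s≤s⁻¹ t<s))
... | false | false = ⊈-tail (size<⇒⊈ (tail s) (tail t) t<s)
... | false | true  = ⊈-tail (size<⇒⊈ (tail s) (tail t) (<-trans (n<1+n _) t<s))

subset-antichain : ∀ L w → IsAntichain (subset L w)
subset-antichain zero zero zero zero 0≢0 = contradiction refl 0≢0
subset-antichain (suc L) zero zero zero 0≢0 = contradiction refl 0≢0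
subset-antichain (suc L) (suc w) i j i≢j
  with splitAt (choose L w) i in eᵢ | splitAt (choose L w) j in eⱼ
... | inj₁ i′ | inj₁ j′ = ⊈-tail (subset-antichain L w i′ j′ λ e →
        i≢j (trans (sym (splitAt⁻¹-↑ˡ eᵢ)) (trans (cong (_↑ˡ _) e) (splitAt⁻¹-↑ˡ eⱼ))))
... | inj₂ i′ | inj₂ j′ = ⊈-tail (subset-antichain L (suc w) i′ j′ λ e →
        i≢j (trans (sym (splitAt⁻¹-↑ʳ eᵢ)) (trans (cong (_ ↑ʳ_) e) (splitAt⁻¹-↑ʳ eⱼ))))
... | inj₁ i′ | inj₂ j′ = zero , refl , refl
... | inj₂ i′ | inj₁ j′ = ⊈-tail (size<⇒⊈ (subset L (suc w) i′) (subset L w j′)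
        (subst₂ _<_ (sym (size-subset L w j′)) (sym (size-subset L (suc w) i′)) (n<1+n w)))

choose-zero : ∀ L → choose L 0 ≡ 1
choose-zero zero = refl
choose-zero (suc L) = refl

choose-> : ∀ L w → L < w → choose L w ≡ 0
choose-> zero (suc w) _ = refl
choose-> (suc L) (suc w) L<w
  rewrite choose-> L w (s≤s⁻¹ L<w) | choose-> L (suc w) (m<n⇒m<1+n (s≤s⁻¹ L<w)) = refl

sumBelow : ℕ → (ℕ → ℕ) → ℕ
sumBelow zero f = 0
sumBelow (suc n) f = f 0 + sumBelow n (f ∘ suc)

sumBelow-+ : ∀ n f g → sumBelow n (λ i → f i + g i) ≡ sumBelow n f + sumBelow n g
sumBelow-+ zero f g = refl
sumBelow-+ (suc n) f g = begin
  f 0 + g 0 + sumBelow n (λ i → f (suc i) + g (suc i))          ≡⟨ cong (f 0 + g 0 +_) (sumBelow-+ n (f ∘ suc) (g ∘ suc)) ⟩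
  f 0 + g 0 + (sumBelow n (f ∘ suc) + sumBelow n (g ∘ suc))    ≡⟨ +-interchange (f 0) (g 0) _ _ ⟩
  f 0 + sumBelow n (f ∘ suc) + (g 0 + sumBelow n (g ∘ suc))    ∎
  where open ≡-Reasoning

sumBelow-suc : ∀ n f → sumBelow (suc n) f ≡ sumBelow n f + f n
sumBelow-suc zero f = +-comm (f 0) 0
sumBelow-suc (suc n) f = trans (cong (f 0 +_) (sumBelow-suc n (f ∘ suc))) (sym (+-assoc (f 0) _ _))

sumBelow-choose : ∀ L → sumBelow (suc L) (choose L) ≡ 2 ^ L
sumBelow-choose zero = refl
sumBelow-choose (suc L) = begin
  1 + sumBelow (suc L) (λ w → choose L w + choose L (suc w))  ≡⟨ cong suc (sumBelow-+ (suc L) (choose L) (choose L ∘ suc)) ⟩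
  1 + (S + S′)                                                ≡⟨ cong suc (+-comm S S′) ⟩
  1 + S′ + S                                                  ≡˘⟨ cong (λ x → x + S′ + S) (choose-zero L) ⟩
  sumBelow (2 + L) (choose L) + S                             ≡⟨ cong (_+ S) (sumBelow-suc (suc L) (choose L)) ⟩
  S + choose L (suc L) + S                                    ≡⟨ cong (λ x → S + x + S) (choose-> L (suc L) ≤-refl) ⟩
  S + 0 + S                                                   ≡⟨ cong (_+ S) (+-identityʳ S) ⟩
  S + S                                                       ≡⟨ cong₂ _+_ (sumBelow-choose L) (sumBelow-choose L) ⟩
  2 ^ L + 2 ^ L                                               ≡⟨ cong (2 ^ L +_) (sym (+-identityʳ (2 ^ L))) ⟩
  2 * 2 ^ L                                                   ∎
  where
  open ≡-Reasoning
  S S′ : ℕ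
  S = sumBelow (suc L) (choose L)
  S′ = sumBelow (suc L) (choose L ∘ suc)

sumBelow-average : ∀ n f → ∃ λ i → i ≤ n × sumBelow (suc n) f ≤ suc n * f i
sumBelow-average zero f = 0 , z≤n , ≤-refl
sumBelow-average (suc n) f with sumBelow-average n (f ∘ suc)
... | i , i≤n , S≤ with f 0 ≤? f (suc i)
...   | yes f₀≤ = suc i , s≤s i≤n , +-mono-≤ f₀≤ S≤
...   | no f₀≰ = 0 , z≤n , +-monoʳ-≤ (f 0) (≤-trans S≤ (*-monoʳ-≤ (suc n) (<⇒≤ (≰⇒> f₀≰))))

large-layer : ∀ L → ∃ λ w → 2 ^ L ≤ suc L * choose L w
large-layer L =
  let w , _ , S≤ = sumBelow-average L (choose L)
  in w , subst (_≤ suc L * choose L w) (sumBelow-choose L) S≤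

eventuallyCAN≤-fromLayer : ∀ v L p q → suc L ^ p * 2 ^ (q * (L * pairs v + v)) < (2 ^ L) ^ p →
                           EventuallyCAN≤ 2 v p q
eventuallyCAN≤-fromLayer v L p q small =
  eventuallyCAN≤-fromPairCA p q (antichain-PairCA v (subset L w) (subset-antichain L w))
    (*-cancelˡ-< (suc L ^ p) _ _ (begin-strict
      suc L ^ p * 2 ^ (q * (L * pairs v + v))  <⟨ small ⟩
      (2 ^ L) ^ p                              ≤⟨ ^-monoˡ-≤ p 2^L≤ ⟩
      (suc L * choose L w) ^ p                 ≡⟨ ^-distribʳ-* (suc L) (choose L w) p ⟩
      suc L ^ p * choose L w ^ p               ∎))
  where
  open ≤-Reasoning
  w : ℕ
  w = proj₁ (large-layer L)
  2^L≤ : 2 ^ L ≤ suc L * choose L w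
  2^L≤ = proj₂ (large-layer L)

-- Binary covering arrays

[5+d]²<2^[5+d] : ∀ d → (5 + d) * (5 + d) < 2 ^ (5 + d)
[5+d]²<2^[5+d] zero = ≤ᵇ⇒≤ 26 32 tt
[5+d]²<2^[5+d] (suc d) = begin-strict
  (6 + d) * (6 + d)                          ≤⟨ m≤m+n _ (d * d + 8 * d + 14) ⟩
  (6 + d) * (6 + d) + (d * d + 8 * d + 14)   ≡⟨ grow d ⟩
  2 * ((5 + d) * (5 + d))                    <⟨ *-monoʳ-< 2 ([5+d]²<2^[5+d] d) ⟩
  2 * 2 ^ (5 + d)                            ∎
  where
  open ≤-Reasoning
  grow : ∀ d → (6 + d) * (6 + d) + (d * d + 8 * d + 14) ≡ 2 * ((5 + d) * (5 + d))
  grow = solve-∀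

[6+c]*c<2^[5+c] : ∀ c → (6 + c) * c < 2 ^ (5 + c)
[6+c]*c<2^[5+c] c = begin-strict
  (6 + c) * c                      ≤⟨ m≤m+n ((6 + c) * c) (4 * c + 25) ⟩
  (6 + c) * c + (4 * c + 25)       ≡⟨ square c ⟩
  (5 + c) * (5 + c)                <⟨ [5+d]²<2^[5+d] c ⟩
  2 ^ (5 + c)                      ∎
  where
  open ≤-Reasoning
  square : ∀ c → (6 + c) * c + (4 * c + 25) ≡ (5 + c) * (5 + c)
  square = solve-∀

-- With L = 2^e the losses (L+1)^p ≤ 2^((e+1) p) and 2^(2q) are beaten by 2^(L (p - q)) ≥ 2^L.
d[2,2]≤1 : dLe 2 2 Above1
d[2,2]≤1 p q _ q<p = eventuallyCAN≤-fromLayer 2 L p q (begin-strict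
  suc L ^ p * 2 ^ (q * (L * 1 + 2))        ≤⟨ *-monoˡ-≤ _ (^-monoˡ-≤ p 1+L≤2^[1+e]) ⟩
  (2 ^ suc e) ^ p * 2 ^ (q * (L * 1 + 2))  ≡⟨ cong (_* 2 ^ (q * (L * 1 + 2))) (^-*-assoc 2 (suc e) p) ⟩
  2 ^ (suc e * p) * 2 ^ (q * (L * 1 + 2))  ≡˘⟨ ^-distribˡ-+-* 2 (suc e * p) _ ⟩
  2 ^ (suc e * p + q * (L * 1 + 2))        <⟨ ^-monoʳ-< 2 ≤-refl exponent< ⟩
  2 ^ (L * p)                              ≡˘⟨ ^-*-assoc 2 L p ⟩
  (2 ^ L) ^ p                              ∎)
  where
  open ≤-Reasoning
  c e L : ℕ
  c = p + 2 * q
  e = 5 + c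
  L = 2 ^ e
  1+L≤2^[1+e] : suc L ≤ 2 ^ suc e
  1+L≤2^[1+e] = subst (suc L ≤_) (cong (L +_) (sym (+-identityʳ L))) (+-monoˡ-≤ L (m^n>0 2 e))
  exponent< : suc e * p + q * (L * 1 + 2) < L * p
  exponent< = begin-strict
    suc e * p + q * (L * 1 + 2)        ≡⟨ regroup (suc e) p q L ⟩
    suc e * p + 2 * q + q * L          ≤⟨ +-monoˡ-≤ (q * L) (+-monoʳ-≤ (suc e * p) (m≤n*m (2 * q) (suc e))) ⟩
    suc e * p + suc e * (2 * q) + q * L  ≡˘⟨ cong (_+ q * L) (*-distribˡ-+ (suc e) p (2 * q)) ⟩
    suc e * c + q * L                  <⟨ +-monoˡ-< (q * L) ([6+c]*c<2^[5+c] c) ⟩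
    L + q * L                          ≡⟨ *-comm (suc q) L ⟩
    L * suc q                          ≤⟨ *-monoʳ-≤ L q<p ⟩
    L * p                              ∎
    where
    regroup : ∀ x p q L → x * p + q * (L * 1 + 2) ≡ x * p + 2 * q + q * L
    regroup = solve-∀

two-injective : ∀ {k} {i j : Fin k} → i ≢ j → Injective _≡_ _≡_ (i ∷ j ∷ [])
two-injective i≢j {zero}     {zero}     _   = refl
two-injective i≢j {zero}     {suc zero} i≡j = contradiction i≡j i≢j
two-injective i≢j {suc zero} {zero}     j≡i = contradiction (sym j≡i) i≢j
two-injective i≢j {suc zero} {suc zero} _   = refl

-- Two distinct columns must differ in some row, since the pattern (0, 1) appears on them.
CA⇒k≤v^N : ∀ {N k v} → CA N 2 k (2 + v) → k ≤ (2 + v) ^ N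
CA⇒k≤v^N {N} {k} {v} (A , cover) = injective⇒≤ column-injective
  where
  column : Fin k → Fin ((2 + v) ^ N)
  column c = funToFin (λ r → A r c)

  column-injective : Injective _≡_ _≡_ column
  column-injective {i} {j} eq with i ≟ᶠ j
  ... | yes i≡j = i≡j
  ... | no i≢j with cover (i ∷ j ∷ []) (two-injective i≢j) (zero ∷ suc zero ∷ [])
  ...   | r , hits = contradiction (trans (sym (hits zero)) (trans same-row (hits (suc zero)))) λ ()
    where
    same-row : A r i ≡ A r j
    same-row = trans (sym (finToFun-funToFin (λ r → A r i) r))
                     (trans (cong (λ f → finToFun f r) eq) (finToFun-funToFin (λ r → A r j) r))

d[2,2]≥1 : dGe 2 2 Below1
d[2,2]≥1 p q _ p<q K = K + 2 , m≤m+n K 2 , λ N ca → lower N (CA⇒k≤v^N ca)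
  where
  lower : ∀ N → K + 2 ≤ 2 ^ N → (K + 2) ^ p < 2 ^ (q * N)
  lower zero k≤1 = contradiction (≤-trans (m≤n+m 2 K) k≤1) λ { (s≤s ()) }
  lower N@(suc _) k≤2^N = begin-strict
    (K + 2) ^ p   ≤⟨ ^-monoˡ-≤ p k≤2^N ⟩
    (2 ^ N) ^ p   ≡⟨ ^-*-assoc 2 N p ⟩
    2 ^ (N * p)   <⟨ ^-monoʳ-< 2 ≤-refl (*-monoʳ-< N p<q) ⟩
    2 ^ (N * q)   ≡⟨ cong (2 ^_) (*-comm N q) ⟩
    2 ^ (q * N)   ∎
    where open ≤-Reasoning

-- Three or more symbols

ratioNum ratioDen : ℕ → ℕ
ratioNum v = v ^ v * (v ∸ 2) ^ (v ∸ 2)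
ratioDen v = (v ∸ 1) ^ (2 * (v ∸ 1))

-- With a = n + 1 this is ratioNum/ratioDen ≤ a/(a - 1); it is Bernoulli's
-- inequality for (1 - 1/a²)^a.
ratio-≤ : ∀ n → ratioNum (2 + n) * n ≤ suc n * ratioDen (2 + n)
ratio-≤ n = *-cancelˡ-≤ (suc n) (begin
  suc n * ((2 + n) ^ (2 + n) * n ^ n * n)   ≡⟨ regroup (suc n) (2 + n) ((2 + n) ^ suc n) (n ^ n) n ⟩
  n ^ suc n * (2 + n) ^ suc n * (suc n * (2 + n))
      ≡˘⟨ cong₂ _*_ (^-distribʳ-* n (2 + n) (suc n)) (pascal n) ⟩
  W ^ suc n * (suc W + suc n)               ≤⟨ bernoulli W (suc n) ⟩
  suc W ^ (2 + n)                           ≡⟨ cong (_^ (2 + n)) (square n) ⟩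
  (suc n * suc n) ^ (2 + n)                 ≡⟨ ^-distribʳ-* (suc n) (suc n) (2 + n) ⟩
  suc n ^ (2 + n) * suc n ^ (2 + n)         ≡⟨ regroup′ (suc n) (suc n ^ suc n) ⟩
  suc n * (suc n * (suc n ^ suc n * suc n ^ suc n))  ≡˘⟨ cong (λ x → suc n * (suc n * x)) (^-double (suc n) (suc n)) ⟩
  suc n * (suc n * ratioDen (2 + n))        ∎)
  where
  open ≤-Reasoning
  W : ℕ
  W = n * (2 + n)
  regroup : ∀ s a P Q n → s * (a * P * Q * n) ≡ n * Q * P * (s * a)
  regroup = solve-∀
  pascal : ∀ n → suc (n * (2 + n)) + suc n ≡ suc n * (2 + n)
  pascal = solve-∀
  square : ∀ n → suc (n * (2 + n)) ≡ suc n * suc n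
  square = solve-∀
  regroup′ : ∀ s R → s * R * (s * R) ≡ s * (s * (R * R))
  regroup′ = solve-∀

-- (1 + 1/m)^(m+1) decreases in m, so it is at most its value 27/8 at m = 2.
[1+1/m]^[m+1]≤27/8 : ∀ n → 8 * (3 + n) ^ (3 + n) ≤ 27 * (2 + n) ^ (3 + n)
[1+1/m]^[m+1]≤27/8 zero = ≤-refl
[1+1/m]^[m+1]≤27/8 (suc n) = *-cancelʳ-≤ _ _ ((2 + n) ^ (3 + n)) {{m^n≢0 (2 + n) (3 + n)}} (begin
  8 * (4 + n) ^ (4 + n) * (2 + n) ^ (3 + n)        ≡⟨ regroup 8 ((4 + n) ^ (4 + n)) ((2 + n) ^ (2 + n)) (2 + n) ⟩
  8 * (ratioNum (4 + n) * (2 + n))                 ≤⟨ *-monoʳ-≤ 8 (ratio-≤ (2 + n)) ⟩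
  8 * ((3 + n) * ratioDen (4 + n))                 ≡⟨ cong (λ x → 8 * ((3 + n) * x)) (^-double (3 + n) (3 + n)) ⟩
  8 * ((3 + n) * ((3 + n) ^ (3 + n) * (3 + n) ^ (3 + n)))
                                                   ≡⟨ regroup′ 8 (3 + n) ((3 + n) ^ (3 + n)) ⟩
  8 * (3 + n) ^ (3 + n) * (3 + n) ^ (4 + n)        ≤⟨ *-monoˡ-≤ _ ([1+1/m]^[m+1]≤27/8 n) ⟩
  27 * (2 + n) ^ (3 + n) * (3 + n) ^ (4 + n)       ≡⟨ xy∙z≈xz∙y 27 ((2 + n) ^ (3 + n)) ((3 + n) ^ (4 + n)) ⟩
  27 * (3 + n) ^ (4 + n) * (2 + n) ^ (3 + n)       ∎)
  where
  open ≤-Reasoning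
  regroup : ∀ e A B c → e * A * (c * B) ≡ e * (A * B * c)
  regroup = solve-∀
  regroup′ : ∀ e c R → e * (c * (R * R)) ≡ e * R * (c * R)
  regroup′ = solve-∀

ratio^a-≤ : ∀ n → 8 * ratioNum (3 + n) ^ (2 + n) ≤ 27 * ratioDen (3 + n) ^ (2 + n)
ratio^a-≤ zero = ≤ᵇ⇒≤ (8 * 27 ^ 2) (27 * 16 ^ 2) tt
ratio^a-≤ (suc n) = *-cancelʳ-≤ _ _ ((2 + n) ^ (3 + n)) {{m^n≢0 (2 + n) (3 + n)}} (begin
  8 * Y ^ (3 + n) * (2 + n) ^ (3 + n)     ≡⟨ *-assoc 8 (Y ^ (3 + n)) ((2 + n) ^ (3 + n)) ⟩
  8 * (Y ^ (3 + n) * (2 + n) ^ (3 + n))   ≡˘⟨ cong (8 *_) (^-distribʳ-* Y (2 + n) (3 + n)) ⟩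
  8 * (Y * (2 + n)) ^ (3 + n)             ≤⟨ *-monoʳ-≤ 8 (^-monoˡ-≤ (3 + n) (ratio-≤ (2 + n))) ⟩
  8 * ((3 + n) * X) ^ (3 + n)             ≡⟨ cong (8 *_) (^-distribʳ-* (3 + n) X (3 + n)) ⟩
  8 * ((3 + n) ^ (3 + n) * X ^ (3 + n))   ≡˘⟨ *-assoc 8 ((3 + n) ^ (3 + n)) (X ^ (3 + n)) ⟩
  8 * (3 + n) ^ (3 + n) * X ^ (3 + n)     ≤⟨ *-monoˡ-≤ (X ^ (3 + n)) ([1+1/m]^[m+1]≤27/8 n) ⟩
  27 * (2 + n) ^ (3 + n) * X ^ (3 + n)    ≡⟨ xy∙z≈xz∙y 27 ((2 + n) ^ (3 + n)) (X ^ (3 + n)) ⟩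
  27 * X ^ (3 + n) * (2 + n) ^ (3 + n)    ∎)
  where
  open ≤-Reasoning
  Y X : ℕ
  Y = ratioNum (4 + n)
  X = ratioDen (4 + n)

ratio≤2 : ∀ n → ratioNum (3 + n) ≤ 2 * ratioDen (3 + n)
ratio≤2 n = *-cancelʳ-≤ _ _ (suc n) (begin
  ratioNum (3 + n) * suc n        ≤⟨ ratio-≤ (suc n) ⟩
  (2 + n) * ratioDen (3 + n)      ≤⟨ *-monoˡ-≤ (ratioDen (3 + n)) (≤-trans (m≤m+n (2 + n) n) (≤-reflexive (double n))) ⟩
  2 * suc n * ratioDen (3 + n)    ≡⟨ xy∙z≈xz∙y 2 (suc n) (ratioDen (3 + n)) ⟩
  2 * ratioDen (3 + n) * suc n    ∎)
  where
  open ≤-Reasoning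
  double : ∀ n → 2 + n + n ≡ 2 * suc n
  double = solve-∀

^-block-≤ : ∀ c d e x y a h → c * y ^ a ≤ d * x ^ a → y ≤ e * x →
            c ^ h * y ^ suc (h * a) ≤ e * d ^ h * x ^ suc (h * a)
^-block-≤ c d e x y a h cyᵃ≤dxᵃ y≤ex = begin
  c ^ h * (y * y ^ (h * a))       ≡⟨ cong (λ z → c ^ h * (y * z)) (^-*-comm y h a) ⟩
  c ^ h * (y * (y ^ a) ^ h)       ≡⟨ x∙yz≈y∙xz (c ^ h) y ((y ^ a) ^ h) ⟩
  y * (c ^ h * (y ^ a) ^ h)       ≡˘⟨ cong (y *_) (^-distribʳ-* c (y ^ a) h) ⟩
  y * (c * y ^ a) ^ h             ≤⟨ *-mono-≤ y≤ex (^-monoˡ-≤ h cyᵃ≤dxᵃ) ⟩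
  e * x * (d * x ^ a) ^ h         ≡⟨ cong (e * x *_) (^-distribʳ-* d (x ^ a) h) ⟩
  e * x * (d ^ h * (x ^ a) ^ h)   ≡⟨ regroup e x (d ^ h) ((x ^ a) ^ h) ⟩
  e * d ^ h * (x * (x ^ a) ^ h)   ≡˘⟨ cong (λ z → e * d ^ h * (x * z)) (^-*-comm x h a) ⟩
  e * d ^ h * (x * x ^ (h * a))   ∎
  where
  open ≤-Reasoning
  regroup : ∀ e x y z → e * x * (y * z) ≡ e * y * (x * z)
  regroup = solve-∀

-- Thirty blocks of v - 1 factors; the closing numerical step 122 · 27³⁰ ≤ 32³⁰ holds as (32/27)³⁰ > 163.
ratio^m-≤ : ∀ n → 61 * ratioNum (3 + n) ^ suc (30 * (2 + n)) ≤ 2 ^ 60 * ratioDen (3 + n) ^ suc (30 * (2 + n))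
ratio^m-≤ n = *-cancelʳ-≤ _ _ (8 ^ 30) (begin
  61 * Y ^ m * 8 ^ 30             ≡⟨ xy∙z≈x∙zy 61 (Y ^ m) (8 ^ 30) ⟩
  61 * (8 ^ 30 * Y ^ m)           ≤⟨ *-monoʳ-≤ 61 (^-block-≤ 8 27 2 X Y (2 + n) 30 (ratio^a-≤ n) (ratio≤2 n)) ⟩
  61 * (2 * 27 ^ 30 * X ^ m)      ≡˘⟨ *-assoc 61 (2 * 27 ^ 30) (X ^ m) ⟩
  61 * (2 * 27 ^ 30) * X ^ m      ≤⟨ *-monoˡ-≤ (X ^ m) (≤ᵇ⇒≤ (61 * (2 * 27 ^ 30)) (2 ^ 60 * 8 ^ 30) tt) ⟩
  2 ^ 60 * 8 ^ 30 * X ^ m         ≡⟨ xy∙z≈xz∙y (2 ^ 60) (8 ^ 30) (X ^ m) ⟩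
  2 ^ 60 * X ^ m * 8 ^ 30         ∎)
  where
  open ≤-Reasoning
  Y X m : ℕ
  Y = ratioNum (3 + n)
  X = ratioDen (3 + n)
  m = suc (30 * (2 + n))

exponent-trade : ∀ {b c K X Y} m p .{{_ : NonZero c}} .{{_ : NonZero X}} .{{_ : NonZero m}} →
                 b * X ^ p < Y ^ p → c * Y ^ m ≤ K * X ^ m → c ^ p * b ^ m < K ^ p
exponent-trade {b} {c} {K} {X} {Y} m p bXᵖ<Yᵖ cYᵐ≤KXᵐ =
  *-cancelʳ-< ((X ^ p) ^ m) _ _ (begin-strict
    c ^ p * b ^ m * (X ^ p) ^ m     ≡⟨ *-assoc (c ^ p) (b ^ m) _ ⟩
    c ^ p * (b ^ m * (X ^ p) ^ m)   ≡˘⟨ cong (c ^ p *_) (^-distribʳ-* b (X ^ p) m) ⟩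
    c ^ p * (b * X ^ p) ^ m         <⟨ *-monoʳ-< (c ^ p) {{m^n≢0 c p}} (^-monoˡ-< m bXᵖ<Yᵖ) ⟩
    c ^ p * (Y ^ p) ^ m             ≡⟨ cong (c ^ p *_) (^-comm Y p m) ⟩
    c ^ p * (Y ^ m) ^ p             ≡˘⟨ ^-distribʳ-* c (Y ^ m) p ⟩
    (c * Y ^ m) ^ p                 ≤⟨ ^-monoˡ-≤ p cYᵐ≤KXᵐ ⟩
    (K * X ^ m) ^ p                 ≡⟨ ^-distribʳ-* K (X ^ m) p ⟩
    K ^ p * (X ^ m) ^ p             ≡⟨ cong (K ^ p *_) (^-comm X m p) ⟩
    K ^ p * (X ^ p) ^ m             ∎)
  where
  open ≤-Reasoning
  instance
    Xᵖᵐ≢0 : NonZero ((X ^ p) ^ m)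
    Xᵖᵐ≢0 = m^n≢0 (X ^ p) m {{m^n≢0 X p}}
  ^-comm : ∀ x i j → (x ^ i) ^ j ≡ (x ^ j) ^ i
  ^-comm x i j = trans (^-*-assoc x i j) (^-*-comm x i j)

d[2,v]≤ : (v : ℕ) → v ≥ 3 → dLe 2 v (AboveBound v)
d[2,v]≤ 1 (s≤s ())
d[2,v]≤ 2 (s≤s (s≤s ()))
d[2,v]≤ v@(suc (suc (suc n))) _ p q _ above = eventuallyCAN≤-fromLayer v 60 p q (begin-strict
  61 ^ p * 2 ^ (q * (60 * pairs v + v))  ≡⟨ cong (λ N → 61 ^ p * 2 ^ (q * N)) rows ⟩
  61 ^ p * 2 ^ (q * (v * m))             ≡⟨ cong (61 ^ p *_) (trans (cong (2 ^_) (regroup q v m)) (sym (^-*-assoc 2 (v * q) m))) ⟩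
  61 ^ p * (2 ^ (v * q)) ^ m             <⟨ exponent-trade {2 ^ (v * q)} {61} {2 ^ 60} {ratioDen v} {ratioNum v} m p above′ (ratio^m-≤ n) ⟩
  (2 ^ 60) ^ p                           ∎)
  where
  open ≤-Reasoning
  m : ℕ
  m = suc (30 * (2 + n))
  rows : 60 * pairs v + v ≡ v * m
  rows = begin-equality
    60 * pairs v + v              ≡⟨ regroup′ (pairs v) v ⟩
    30 * (pairs v * 2) + v        ≡⟨ cong (λ x → 30 * x + v) (pairs-double (2 + n)) ⟩
    30 * (v * (2 + n)) + v        ≡⟨ factor n ⟩
    v * m                         ∎
    where
    regroup′ : ∀ P v → 60 * P + v ≡ 30 * (P * 2) + v
    regroup′ = solve-∀
    factor : ∀ n → 30 * ((3 + n) * (2 + n)) + (3 + n) ≡ (3 + n) * suc (30 * (2 + n))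
    factor = solve-∀
  regroup : ∀ q v m → q * (v * m) ≡ v * q * m
  regroup = solve-∀
  above′ : 2 ^ (v * q) * ratioDen v ^ p < ratioNum v ^ p
  above′ = subst (λ x → 2 ^ (v * q) * x < ratioNum v ^ p) (sym (^-*-assoc (2 + n) (2 * (2 + n)) p)) above
  instance
    ratioDen≢0 : NonZero (ratioDen v)
    ratioDen≢0 = m^n≢0 (2 + n) (2 * (2 + n))

mainTheorem3 : (dLe 2 2 Above1 × dGe 2 2 Below1)
    × ((v : ℕ) → v ≥ 3 → dLe 2 v (AboveBound v))
mainTheorem3 = (d[2,2]≤1 , d[2,2]≥1) , d[2,v]≤
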